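{- Let $G$ be an abelian group and let $A\subseteq G$ be a finite subset with $|A|\geqslant 5$, and suppose that $A$ is not an almost $2$-coset. Then \[|2\wedge A|\leqslant |A|\quad\Longleftrightarrow\quad |A+A|=|A|.\]
   Context: $2\wedge A:=\{x+y: x,y\in A,\ x\neq y\}$ and $A+A:=\{x+y:x,y\in A\}$. An elementary $2$-subgroup of $G$ is a finite subgroup in which every non-identity element has order $2$; a $2$-coset is a coset of such a subgroup; an almost $2$-coset is a set obtained from a $2$-coset by removing exactly one element. -}

module Defs where

open import Level using (_⊔_)
open import Algebra.Bundles using (AbelianGroup)
open import Data.List using (List; length)
open import Data.List.Relation.Unary.Any using (Any)
open import Data.List.Relation.Unary.AllPairs using (AllPairs)
open import Data.Nat using (ℕ)
open import Data.Product using (Σ; _×_; ∃; ∃-syntax)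
open import Function.Bundles using (_⇔_)
open import Relation.Nullary using (¬_)
open import Relation.Binary.PropositionalEquality using (_≡_)

module _ {c ℓ} (G : AbelianGroup c ℓ) where
  open AbelianGroup G

  _∈L_ : Carrier → List Carrier → Set (c ⊔ ℓ)
  x ∈L L = Any (x ≈_) L

  -- a list of pairwise distinct elements (a finite subset of G)
  Distinct : List Carrier → Set (c ⊔ ℓ)
  Distinct L = AllPairs (λ x y → ¬ (x ≈ y)) L

  IsElementary2Subgroup : List Carrier → Set (c ⊔ ℓ)
  IsElementary2Subgroup H =
    (ε ∈L H)
    × (∀ x y → x ∈L H → y ∈L H → (x ∙ y) ∈L H)
    × (∀ x → x ∈L H → (x ⁻¹) ∈L H)
    × (∀ x → x ∈L H → ¬ (x ≈ ε) → (x ∙ x) ≈ ε)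

  InCoset : Carrier → List Carrier → Carrier → Set (c ⊔ ℓ)
  InCoset g H x = ∃[ h ] (h ∈L H × x ≈ (g ∙ h))

  IsAlmost2Coset : List Carrier → Set (c ⊔ ℓ)
  IsAlmost2Coset A =
    ∃[ H ] ∃[ g ] ∃[ z ]
      ( IsElementary2Subgroup H
      × InCoset g H z
      × (∀ x → (x ∈L A) ⇔ (InCoset g H x × ¬ (x ≈ z))))

  In2Wedge : List Carrier → Carrier → Set (c ⊔ ℓ)
  In2Wedge A x = ∃[ a ] ∃[ b ] (a ∈L A × b ∈L A × ¬ (a ≈ b) × x ≈ (a ∙ b))

  InSumset : List Carrier → Carrier → Set (c ⊔ ℓ)
  InSumset A x = ∃[ a ] ∃[ b ] (a ∈L A × b ∈L A × x ≈ (a ∙ b))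

  HasSize : (Carrier → Set (c ⊔ ℓ)) → ℕ → Set (c ⊔ ℓ)
  HasSize P n = Σ (List Carrier) λ L →
    Distinct L × length L ≡ n × (∀ x → P x ⇔ (x ∈L L))

module Submission where

-- Since 2∧A ⊆ A + A and a + A ⊆ A + A, the direction "⇐" and the bound
-- |A| ≤ |A + A| are immediate.  The content is "|2∧A| ≤ |A| ⇒ |A + A| ≤ |A|".
-- If 2a ∈ 2∧A for all a ∈ A, then A + A = 2∧A.  Otherwise pick b ∈ A with
-- 2b ∉ 2∧A and put B = A - b: then 0 ∈ B, 0 ∉ 2∧B and |2∧B| ≤ |B|.  The
-- closure criterion shows that such a B is closed under addition unless
-- B ∪ {s} is an elementary 2-subgroup for some s ∉ B (which would make A an
-- almost 2-coset); closedness of B means A + A ⊆ b + A.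
--
-- The closure criterion rests on one counting fact: for x ∈ B the |B| - 1
-- elements x + (B ∖ {x}) lie in 2∧B, so a set of at most |B| elements
-- containing them has at most one further element.

open import Defs
open import Level using (Level; _⊔_)
open import Algebra.Bundles using (AbelianGroup)
open import Data.Empty using (⊥)
open import Data.List using (List; []; _∷_; length; map)
open import Data.List.Properties using (length-map; length-removeAt′)
open import Data.List.Relation.Unary.Any using (here; there; index)
open import Data.List.Relation.Unary.All using (All; []; _∷_)
open import Data.List.Relation.Unary.AllPairs using ([]; _∷_)
open import Data.List.Membership.Setoid.Properties
  using (∈-resp-≈; ∈-map⁺; ∈-map⁻; ∉⇒All[≉]; All[≉]⇒∉)
import Data.List.Relation.Unary.Unique.Setoid.Properties as Unique
open import Data.Nat using (ℕ; suc; _≤_; _<_; _≤?_; s≤s; z≤n)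
open import Data.Nat.Properties using (≤-trans; ≤-reflexive; ≤-antisym; <⇒≱)
open import Data.Product using (∃; _×_; _,_; proj₁; proj₂)
open import Data.Sum using (_⊎_; inj₁; inj₂)
open import Function.Bundles using (_⇔_; mk⇔; Equivalence)
open import Relation.Binary.Bundles using (Setoid)
open import Relation.Binary.PropositionalEquality using (_≡_)
import Relation.Binary.PropositionalEquality as ≡
open import Relation.Nullary using (¬_; yes; no)
open import Relation.Nullary.Decidable using (¬¬-excluded-middle; decidable-stable)
open import Relation.Nullary.Negation using (contradiction)

-- Equality in a setoid is not decidable, so the
-- combinatorial arguments below are carried out under ¬ ¬; the final
-- conclusions are decidable statements about ℕ and hence stable.
module DoubleNegation where
  private variable a b : Level; A : Set a; B : Set b

  return : A → ¬ ¬ A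
  return x ¬x = ¬x x

  infixl 1 _>>=_
  _>>=_ : ¬ ¬ A → (A → ¬ ¬ B) → ¬ ¬ B
  (m >>= f) ¬y = m (λ x → f x ¬y)

open DoubleNegation

-- Finite subsets of a setoid, represented by duplicate-free lists.
module FiniteSets {c ℓ} (S : Setoid c ℓ) where
  open Setoid S renaming (Carrier to A)
  open import Data.List.Membership.Setoid S public using (_∈_; _∉_; _─_)
  open import Data.List.Relation.Unary.Unique.Setoid S public using (Unique)

  private variable x y : A; xs ys : List A

  ∈-─⁺ : (p : x ∈ xs) → y ∈ xs → ¬ y ≈ x → y ∈ xs ─ p
  ∈-─⁺ (here x≈z) (here y≈z) y≉x = contradiction (trans y≈z (sym x≈z)) y≉x
  ∈-─⁺ (here _)   (there q)  y≉x = q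
  ∈-─⁺ (there p)  (here y≈z) y≉x = here y≈z
  ∈-─⁺ (there p)  (there q)  y≉x = there (∈-─⁺ p q y≉x)

  ∈-─⁻ : (p : x ∈ xs) → y ∈ xs ─ p → y ∈ xs
  ∈-─⁻ (here _)  q         = there q
  ∈-─⁻ (there p) (here e)  = here e
  ∈-─⁻ (there p) (there q) = there (∈-─⁻ p q)

  ∉-tail : All (x ≉_) xs → y ∈ xs → ¬ y ≈ x
  ∉-tail x≉xs y∈xs y≈x = All[≉]⇒∉ S x≉xs (∈-resp-≈ S y≈x y∈xs)

  ∉-─ : Unique xs → (p : x ∈ xs) → y ∈ xs ─ p → ¬ y ≈ x
  ∉-─ (z≉xs ∷ _)  (here x≈z) q         y≈x = ∉-tail z≉xs q (trans y≈x x≈z)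
  ∉-─ (z≉xs ∷ _)  (there p)  (here y≈z) y≈x = ∉-tail z≉xs p (trans (sym y≈x) y≈z)
  ∉-─ (_ ∷ xs!)   (there p)  (there q)  y≈x = ∉-─ xs! p q y≈x

  Unique-─ : Unique xs → (p : x ∈ xs) → Unique (xs ─ p)
  Unique-─ (_ ∷ xs!)     (here _)  = xs!
  Unique-─ (z≉xs ∷ xs!) (there p) =
    ∉⇒All[≉] S (λ z∈ → ∉-tail z≉xs (∈-─⁻ p z∈) refl) ∷ Unique-─ xs! p

  length-mono : Unique xs → (∀ {x} → x ∈ xs → x ∈ ys) → length xs ≤ length ys
  length-mono {[]}             _            _   = z≤n
  length-mono {_ ∷ _} {ys} (x≉xs ∷ xs!) sub =
    ≤-trans (s≤s (length-mono xs! (λ y∈ → ∈-─⁺ p (sub (there y∈)) (∉-tail x≉xs y∈))))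
            (≤-reflexive (≡.sym (length-removeAt′ ys (index p))))
    where p = sub (here refl)

  ¬¬-∀∈ : ∀ {p} {P : A → Set p} → (∀ {x y} → x ≈ y → P x → P y) →
          ∀ xs → (∀ {x} → x ∈ xs → ¬ ¬ P x) → ¬ ¬ (∀ {x} → x ∈ xs → P x)
  ¬¬-∀∈ resp []       _ = return (λ ())
  ¬¬-∀∈ resp (x ∷ xs) f = do
    Px  ← f (here refl)
    Pxs ← ¬¬-∀∈ resp xs (λ y∈ → f (there y∈))
    return λ { (here y≈x) → resp (sym y≈x) Px ; (there y∈) → Pxs y∈ }

  -- "P has at most n elements": every duplicate-free list of elements of P
  -- (up to double negation) has length at most n.  This is the reading of
  -- |P| ≤ n that is usable without decidable equality.
  AtMost : ∀ {p} → (A → Set p) → ℕ → Set _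
  AtMost P n = ∀ xs → Unique xs → (∀ {x} → x ∈ xs → ¬ ¬ P x) → ¬ ¬ (length xs ≤ n)

  atMost-list : ∀ ys → AtMost (_∈ ys) (length ys)
  atMost-list ys xs xs! xs⊆ys = do
    sub ← ¬¬-∀∈ (∈-resp-≈ S) xs xs⊆ys
    return (length-mono xs! sub)

  module _ {p q} {P : A → Set p} {Q : A → Set q} where

    atMost-⊆ : ∀ {n} → (∀ {x} → P x → ¬ ¬ Q x) → AtMost Q n → AtMost P n
    atMost-⊆ P⊆Q Q≤n xs xs! xs⊆P = Q≤n xs xs! (λ x∈ → xs⊆P x∈ >>= P⊆Q)

    atMost-image : ∀ {n} (f : A → A) → (∀ {x y} → f x ≈ f y → x ≈ y) →
                   (∀ {x y} → x ≈ y → Q x → Q y) → (∀ {x} → P x → Q (f x)) →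
                   AtMost Q n → AtMost P n
    atMost-image f inj Q-resp P⇒Qf Q≤n xs xs! xs⊆P = do
      le ← Q≤n (map f xs) (Unique.map⁺ S S inj xs!) fxs⊆Q
      return (≡.subst (_≤ _) (length-map f xs) le)
      where
      fxs⊆Q : ∀ {y} → y ∈ map f xs → ¬ ¬ Q y
      fxs⊆Q y∈ = do
        let (x , x∈ , y≈fx) = ∈-map⁻ S S y∈
        Px ← xs⊆P x∈
        return (Q-resp (sym y≈fx) (P⇒Qf Px))

  atMost-weaken : ∀ {p} {P : A → Set p} {m n} → AtMost P m → m ≤ n → AtMost P n
  atMost-weaken P≤m m≤n xs xs! xs⊆P = do
    le ← P≤m xs xs! xs⊆P
    return (≤-trans le m≤n)

  ¬¬-outside : ∀ av → Unique xs → length av < length xs →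
               ¬ ¬ (∃ λ x → x ∈ xs × All (x ≉_) av)
  ¬¬-outside av xs! av<xs none =
    atMost-list av _ xs! (λ x∈ x∉ → none (_ , x∈ , ∉⇒All[≉] S x∉)) (<⇒≱ av<xs)

  nonempty : 0 < length xs → ∃ λ x → x ∈ xs
  nonempty {x ∷ _} _ = x , here refl

-- The additive combinatorics of 2∧A and A + A in an abelian group G
-- (written multiplicatively, as in the library: ∙, ε, ⁻¹).
module GroupLemmas {c ℓ} (G : AbelianGroup c ℓ) where
  open AbelianGroup G
  open FiniteSets setoid
  open import Algebra.Properties.AbelianGroup G
    using (∙-cancelˡ; ∙-cancelʳ; identityʳ-unique; identityˡ-unique; inverseʳ-unique)
  open import Algebra.Properties.CommutativeSemigroup commutativeSemigroup
    using (interchange; x∙yz≈y∙xz; xy∙z≈xz∙y; xy∙z≈y∙xz)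
  open import Relation.Binary.Reasoning.Setoid setoid

  private variable a p p′ q r t u v x y z z′ : Carrier

  move-involution : x ∙ x ≈ ε → u ∙ x ≈ v → u ≈ v ∙ x
  move-involution {x} {u} {v} x∙x≈ε u∙x≈v = begin
    u           ≈⟨ identityʳ u ⟨
    u ∙ ε       ≈⟨ ∙-congˡ x∙x≈ε ⟨
    u ∙ (x ∙ x) ≈⟨ assoc u x x ⟨
    (u ∙ x) ∙ x ≈⟨ ∙-congʳ u∙x≈v ⟩
    v ∙ x       ∎

  module _ {L : List Carrier} where

    wedge : x ∈ L → y ∈ L → ¬ x ≈ y → In2Wedge G L (x ∙ y)
    wedge x∈L y∈L x≉y = _ , _ , x∈L , y∈L , x≉y , refl

    wedge-resp : x ≈ y → In2Wedge G L x → In2Wedge G L y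
    wedge-resp x≈y (a , b , a∈L , b∈L , a≉b , x≈ab) =
      a , b , a∈L , b∈L , a≉b , trans (sym x≈y) x≈ab

  -- The closure criterion.  Then B is closed under addition.
  module ClosureCriterion
    (B : List Carrier) (B! : Unique B) (5≤|B| : 5 ≤ length B)
    (ε∈B : ε ∈ B) (ε∉2∧B : ¬ In2Wedge G B ε)
    (2∧B≤|B| : AtMost (In2Wedge G B) (length B))
    (no-extension : ∀ s → s ∉ B → ¬ IsElementary2Subgroup G (s ∷ B))
    where

    W : Carrier → Set (c ⊔ ℓ)
    W = In2Wedge G B

    W⇒≉ε : W x → ¬ x ≈ ε
    W⇒≉ε Wx x≈ε = ε∉2∧B (wedge-resp x≈ε Wx)

    -- Nbhd x y : y ∈ x + (B ∖ {x}).  For x ∈ B these are |B| - 1 distinct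
    -- elements of 2∧B.
    Nbhd : Carrier → Carrier → Set (c ⊔ ℓ)
    Nbhd x y = ∃ λ w → w ∈ B × ¬ w ≈ x × y ≈ x ∙ w

    Nbhd⇒W : x ∈ B → Nbhd x y → W y
    Nbhd⇒W x∈B (w , w∈B , w≉x , y≈xw) =
      wedge-resp (sym y≈xw) (wedge x∈B w∈B (λ x≈w → w≉x (sym x≈w)))

    outsiders-equal : ∀ {x t u} → x ∈ B → (Q : Carrier → Set (c ⊔ ℓ)) →
      (∀ {y z} → y ≈ z → Q y → Q z) → AtMost Q (length B) → (∀ {y} → Nbhd x y → ¬ ¬ Q y) →
      Q t → Q u → ¬ Nbhd x t → ¬ Nbhd x u → ¬ ¬ (t ≈ u)
    outsiders-equal {x} {t} {u} x∈B Q Q-resp Q≤|B| Nbhd⊆Q Qt Qu t∉N u∉N t≉u =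
      Q≤|B| (t ∷ u ∷ N) (t∉ ∷ u∉ ∷ N!) members (<⇒≱ (s≤s (≤-reflexive |B|≡1+|N|)))
      where
      R = B ─ x∈B
      N = map (x ∙_) R
      N⊆Nbhd : y ∈ N → Nbhd x y
      N⊆Nbhd y∈N with ∈-map⁻ setoid setoid y∈N
      ... | w , w∈R , y≈xw = w , ∈-─⁻ x∈B w∈R , ∉-─ B! x∈B w∈R , y≈xw
      N! : Unique N
      N! = Unique.map⁺ setoid setoid (∙-cancelˡ x _ _) (Unique-─ B! x∈B)
      t∉ : All (t ≉_) (u ∷ N)
      t∉ = ∉⇒All[≉] setoid λ { (here t≈u) → t≉u t≈u ; (there t∈N) → t∉N (N⊆Nbhd t∈N) }
      u∉ : All (u ≉_) N
      u∉ = ∉⇒All[≉] setoid λ u∈N → u∉N (N⊆Nbhd u∈N)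
      members : y ∈ t ∷ u ∷ N → ¬ ¬ Q y
      members (here y≈t)                 = return (Q-resp (sym y≈t) Qt)
      members (there (here y≈u))         = return (Q-resp (sym y≈u) Qu)
      members (there (there y∈N))        = Nbhd⊆Q (N⊆Nbhd y∈N)
      |B|≡1+|N| : length B ≡ suc (length N)
      |B|≡1+|N| = ≡.trans (length-removeAt′ B (index x∈B))
                          (≡.cong suc (≡.sym (length-map (x ∙_) R)))

    module WedgeInside (2∧B⊆B : ∀ {t} → W t → ¬ ¬ (t ∈ B)) where

      -- Every y ∈ B ∖ {0} lies in x + (B ∖ {x}): otherwise 0 and y would be
      -- two elements of B outside it.
      covered : x ∈ B → y ∈ B → ¬ y ≈ ε → ¬ ¬ Nbhd x y
      covered x∈B y∈B y≉ε y∉N =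
        outsiders-equal x∈B (_∈ B) (∈-resp-≈ setoid) (atMost-list B)
          (λ n → 2∧B⊆B (Nbhd⇒W x∈B n)) ε∈B y∈B
          (λ n → ε∉2∧B (Nbhd⇒W x∈B n)) y∉N (λ ε≈y → y≉ε (sym ε≈y))

      -- 2x ∈ B forces 2x = 0, since 2x = x + w with w ≠ x is impossible.
      double∈B⇒ε : x ∈ B → x ∙ x ∈ B → ¬ ¬ (x ∙ x ≈ ε)
      double∈B⇒ε {x} x∈B xx∈B xx≉ε =
        covered x∈B xx∈B xx≉ε λ (w , _ , w≉x , xx≈xw) → w≉x (sym (∙-cancelˡ x x w xx≈xw))

      -- Every element of B has order at most 2: take c ∈ B ∖ {0, x} and
      -- write c = x + d.  If 2x ≠ 0 then c + x ≠ d, so 2c = (c + x) + d is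
      -- a nonzero element of 2∧B ⊆ B, contradicting double∈B⇒ε.
      order≤2 : x ∈ B → ¬ ¬ (x ∙ x ≈ ε)
      order≤2 {x} x∈B xx≉ε =
        ¬¬-outside (ε ∷ x ∷ []) B! (≤-trans (s≤s (s≤s (s≤s z≤n))) 5≤|B|)
          λ { (c , c∈B , c≉ε ∷ c≉x ∷ []) →
        covered x∈B c∈B c≉ε λ (d , d∈B , d≉x , c≈xd) →
        2∧B⊆B (wedge c∈B x∈B c≉x) λ cx∈B →
        let cx≉d : ¬ c ∙ x ≈ d
            cx≉d cx≈d = xx≉ε (identityʳ-unique c (x ∙ x) (sym (begin
              c           ≈⟨ c≈xd ⟩
              x ∙ d       ≈⟨ ∙-congˡ cx≈d ⟨
              x ∙ (c ∙ x) ≈⟨ x∙yz≈y∙xz x c x ⟩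
              c ∙ (x ∙ x) ∎)))
            W[cc] : W (c ∙ c)
            W[cc] = wedge-resp (trans (assoc c x d) (∙-congˡ (sym c≈xd))) (wedge cx∈B d∈B cx≉d)
        in 2∧B⊆B W[cc] λ cc∈B → double∈B⇒ε c∈B cc∈B (W⇒≉ε W[cc]) }

      closed : x ∈ B → y ∈ B → ¬ ¬ (x ∙ y ∈ B)
      closed {x} {y} x∈B y∈B = do
        yes x≈y ← ¬¬-excluded-middle
          where no x≉y → 2∧B⊆B (wedge x∈B y∈B x≉y)
        xx≈ε ← order≤2 x∈B
        return (∈-resp-≈ setoid (sym (trans (∙-congˡ (sym x≈y)) xx≈ε)) ε∈B)

    -- Second case: some s ∈ 2∧B lies outside B.  Then H = B ∪ {s} is an
    -- elementary 2-subgroup, contradicting the hypothesis.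
    module WedgeOutside (s : Carrier) (W[s] : W s) (s∉B : s ∉ B) where

      H : List Carrier
      H = s ∷ B

      ∉B⇒∉Nbhd-ε : y ∉ B → ¬ Nbhd ε y
      ∉B⇒∉Nbhd-ε y∉B (w , w∈B , _ , y≈εw) =
        y∉B (∈-resp-≈ setoid (sym (trans y≈εw (identityˡ w))) w∈B)

      -- Since 0 + (B ∖ {0}) ⊆ B, s is the only element of 2∧B outside B.
      2∧B⊆H : W t → ¬ ¬ (t ∈ B ⊎ t ≈ s)
      2∧B⊆H {t} W[t] = do
        no t∉B ← ¬¬-excluded-middle
          where yes t∈B → return (inj₁ t∈B)
        t≈s ← outsiders-equal ε∈B W wedge-resp 2∧B≤|B| (λ n → return (Nbhd⇒W ε∈B n))
                W[t] W[s] (∉B⇒∉Nbhd-ε t∉B) (∉B⇒∉Nbhd-ε s∉B)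
        return (inj₂ t≈s)

      -- Consequences of s ∉ x + (B ∖ {x}) for some x ∈ B ∖ {0}; they are
      -- shown contradictory in Representation.
      module Avoiding {x} (x∈B : x ∈ B) (x≉ε : ¬ x ≈ ε) (s∉Nx : ¬ Nbhd x s) where

        -- s and s + x are distinct elements outside x + (B ∖ {x}).
        s∙x∉2∧B : ¬ W (s ∙ x)
        s∙x∉2∧B W[sx] =
          outsiders-equal x∈B W wedge-resp 2∧B≤|B| (λ n → return (Nbhd⇒W x∈B n))
            W[s] W[sx] s∉Nx sx∉Nx λ s≈sx → x≉ε (identityʳ-unique s x (sym s≈sx))
          where
          sx∉Nx : ¬ Nbhd x (s ∙ x)
          sx∉Nx (w , w∈B , _ , sx≈xw) =
            s∉B (∈-resp-≈ setoid (∙-cancelʳ x w s (trans (comm w x) (sym sx≈xw))) w∈B)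

        partner : p ∈ B → p′ ∈ B → ¬ p′ ≈ p → s ≈ p ∙ p′ → ¬ ¬ (p′ ≈ p ∙ x)
        partner {p} {p′} p∈B p′∈B p′≉p s≈pp′ p′≉px = 2∧B⊆H (wedge p∈B x∈B p≉x) λ
          { (inj₂ px≈s) → s∉Nx (p , p∈B , p≉x , trans (sym px≈s) (comm p x))
          ; (inj₁ px∈B) →
              s∙x∉2∧B (wedge-resp (trans (xy∙z≈xz∙y p x p′) (∙-congʳ (sym s≈pp′)))
                                  (wedge px∈B p′∈B (λ px≈p′ → p′≉px (sym px≈p′)))) }
          where
          p≉x : ¬ p ≈ x
          p≉x p≈x = s∉Nx (p′ , p′∈B , (λ p′≈x → p′≉p (trans p′≈x (sym p≈x))) ,
                          trans s≈pp′ (∙-congʳ p≈x))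

      -- Write s = a + b.  If s ∉ x + (B ∖ {x}), then `partner' gives b = a + x
      -- and a = b + x, and this configuration is contradictory.
      module Representation {x} (x∈B : x ∈ B) (x≉ε : ¬ x ≈ ε) (s∉Nx : ¬ Nbhd x s)
        {a b} (a∈B : a ∈ B) (b∈B : b ∈ B) (a≉b : ¬ a ≈ b) (s≈ab : s ≈ a ∙ b)
        (b≈ax : b ≈ a ∙ x) (a≈bx : a ≈ b ∙ x) where
        open Avoiding x∈B x≉ε s∉Nx

        x∙x≈ε : x ∙ x ≈ ε
        x∙x≈ε = identityʳ-unique a (x ∙ x) (sym (begin
          a           ≈⟨ a≈bx ⟩
          b ∙ x       ≈⟨ ∙-congʳ b≈ax ⟩
          (a ∙ x) ∙ x ≈⟨ assoc a x x ⟩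
          a ∙ (x ∙ x) ∎))

        a≉ε : ¬ a ≈ ε
        a≉ε a≈ε = s∉B (∈-resp-≈ setoid (sym (trans s≈ab (trans (∙-congʳ a≈ε) (identityˡ b)))) b∈B)

        a≉x : ¬ a ≈ x
        a≉x a≈x = s∉Nx (b , b∈B , (λ b≈x → a≉b (trans a≈x (sym b≈x))) ,
                        trans s≈ab (∙-congʳ a≈x))

        -- Each q ∈ B ∖ {0, x} has s ∈ q + (B ∖ {q}); otherwise the
        -- representation s = a + b would give b = a + q = a + x.
        s∈Nbhd-of-others : q ∈ B → ¬ q ≈ ε → ¬ q ≈ x → ¬ ¬ Nbhd q s
        s∈Nbhd-of-others {q} q∈B q≉ε q≉x s∉Nq =
          Avoiding.partner q∈B q≉ε s∉Nq a∈B b∈B (λ b≈a → a≉b (sym b≈a)) s≈ab λ b≈aq →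
          q≉x (∙-cancelˡ a q x (trans (sym b≈aq) b≈ax))

        double≈s∙x : r ∈ B → ¬ r ≈ ε → ¬ r ≈ x → ¬ ¬ (r ∙ r ≈ s ∙ x)
        double≈s∙x {r} r∈B r≉ε r≉x = do
          (w , w∈B , w≉r , s≈rw) ← s∈Nbhd-of-others r∈B r≉ε r≉x
          w≈rx ← partner r∈B w∈B w≉r s≈rw
          return (move-involution x∙x≈ε (begin
            (r ∙ r) ∙ x ≈⟨ assoc r r x ⟩
            r ∙ (r ∙ x) ≈⟨ ∙-congˡ w≈rx ⟨
            r ∙ w       ≈⟨ s≈rw ⟨
            s           ∎))

        -- For q ∈ B ∖ {0, x, a, a + x}: a + q = x.  Otherwise a + q ∈ B ∖ {0, x}
        -- and 2(a + q) = 2a + 2q would give s + x = 0, i.e. s = x ∈ B.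
        sum≈x : q ∈ B → ¬ q ≈ ε → ¬ q ≈ x → ¬ q ≈ a → ¬ q ≈ a ∙ x → ¬ ¬ (a ∙ q ≈ x)
        sum≈x {q} q∈B q≉ε q≉x q≉a q≉ax aq≉x = 2∧B⊆H W[aq] λ
          { (inj₂ aq≈s) → q≉ax (trans (∙-cancelˡ a q b (trans aq≈s s≈ab)) b≈ax)
          ; (inj₁ aq∈B) →
              double≈s∙x aq∈B (W⇒≉ε W[aq]) aq≉x λ aqaq≈sx →
              double≈s∙x q∈B q≉ε q≉x λ qq≈sx →
              double≈s∙x a∈B a≉ε a≉x λ aa≈sx →
              s∉B (∈-resp-≈ setoid (sym (s≈x aqaq≈sx qq≈sx aa≈sx)) x∈B) }
          where
          W[aq] : W (a ∙ q)
          W[aq] = wedge a∈B q∈B (λ a≈q → q≉a (sym a≈q))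
          s≈x : (a ∙ q) ∙ (a ∙ q) ≈ s ∙ x → q ∙ q ≈ s ∙ x → a ∙ a ≈ s ∙ x → s ≈ x
          s≈x aqaq≈sx qq≈sx aa≈sx = trans (move-involution x∙x≈ε sx≈ε) (identityˡ x)
            where
            sx≈ε : s ∙ x ≈ ε
            sx≈ε = identityʳ-unique (s ∙ x) (s ∙ x) (begin
              (s ∙ x) ∙ (s ∙ x) ≈⟨ ∙-cong aa≈sx qq≈sx ⟨
              (a ∙ a) ∙ (q ∙ q) ≈⟨ interchange a a q q ⟩
              (a ∙ q) ∙ (a ∙ q) ≈⟨ aqaq≈sx ⟩
              s ∙ x             ∎)

        -- Take q ∈ B ∖ {0, x, a, a + x} (possible as |B| ≥ 5).  Then a + q = x,
        -- and q + x ∈ B is another such element, so a + q + x = x as well,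
        -- whence x = 2x = 0.
        absurd : ⊥
        absurd =
          ¬¬-outside (ε ∷ x ∷ a ∷ (a ∙ x) ∷ []) B! 5≤|B|
            λ { (q , q∈B , q≉ε ∷ q≉x ∷ q≉a ∷ q≉ax ∷ []) →
          sum≈x q∈B q≉ε q≉x q≉a q≉ax λ aq≈x →
          s∈Nbhd-of-others q∈B q≉ε q≉x λ (w , w∈B , w≉q , s≈qw) →
          partner q∈B w∈B w≉q s≈qw λ w≈qx →
          let qx∈B = ∈-resp-≈ setoid w≈qx w∈B
              qx≉ε : ¬ q ∙ x ≈ ε
              qx≉ε qx≈ε = q≉x (trans (move-involution x∙x≈ε qx≈ε) (identityˡ x))
              qx≉x : ¬ q ∙ x ≈ x
              qx≉x qx≈x = q≉ε (identityˡ-unique q x qx≈x)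
              qx≉a : ¬ q ∙ x ≈ a
              qx≉a qx≈a = q≉ax (move-involution x∙x≈ε qx≈a)
              qx≉ax : ¬ q ∙ x ≈ a ∙ x
              qx≉ax qx≈ax = q≉a (∙-cancelʳ x q a qx≈ax)
          in sum≈x qx∈B qx≉ε qx≉x qx≉a qx≉ax λ aqx≈x →
          x≉ε (begin
            x           ≈⟨ aqx≈x ⟨
            a ∙ (q ∙ x) ≈⟨ assoc a q x ⟨
            (a ∙ q) ∙ x ≈⟨ ∙-congʳ aq≈x ⟩
            x ∙ x       ≈⟨ x∙x≈ε ⟩
            ε           ∎) }

      s∈Nbhd : x ∈ B → ¬ x ≈ ε → ¬ ¬ Nbhd x s
      s∈Nbhd x∈B x≉ε s∉Nx =
        let (a , b , a∈B , b∈B , a≉b , s≈ab) = W[s] in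
        partner a∈B b∈B (λ b≈a → a≉b (sym b≈a)) s≈ab λ b≈ax →
        partner b∈B a∈B a≉b (trans s≈ab (comm a b)) λ a≈bx →
        Representation.absurd x∈B x≉ε s∉Nx a∈B b∈B a≉b s≈ab b≈ax a≈bx
        where open Avoiding x∈B x≉ε s∉Nx

      -- Every x ∈ B ∖ {0} has order 2.  Write s = x + x′ and s = z + z′ with
      -- z ∉ {0, x, x′}; the key step shows that 2x = 0 or x + z = z′.
      module OrderTwo {x x′} (x∈B : x ∈ B) (x≉ε : ¬ x ≈ ε)
        (x′∈B : x′ ∈ B) (x′≉x : ¬ x′ ≈ x) (s≈xx′ : s ≈ x ∙ x′) where

        -- If x + z ≠ z′, then s + x = (x + z) + z′ ∈ 2∧B ∖ {s} lies in B, and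
        -- writing s = (s + x) + r forces x + r = 0, i.e. 2x = 0.
        shift-or-involution : z ∈ B → z′ ∈ B → ¬ z ≈ x → ¬ z ≈ x′ → s ≈ z ∙ z′ →
                              ¬ ¬ (x ∙ x ≈ ε ⊎ x ∙ z ≈ z′)
        shift-or-involution {z} {z′} z∈B z′∈B z≉x z≉x′ s≈zz′ = do
          inj₁ xz∈B ← 2∧B⊆H (wedge x∈B z∈B (λ x≈z → z≉x (sym x≈z)))
            where inj₂ xz≈s → λ _ → z≉x′ (∙-cancelˡ x z x′ (trans xz≈s s≈xx′))
          no xz≉z′ ← ¬¬-excluded-middle
            where yes xz≈z′ → return (inj₂ xz≈z′)
          let W[sx] = wedge-resp (trans (assoc x z z′) (trans (∙-congˡ (sym s≈zz′)) (comm x s)))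
                             (wedge xz∈B z′∈B xz≉z′)
          inj₁ sx∈B ← 2∧B⊆H W[sx]
            where inj₂ sx≈s → λ _ → x≉ε (identityʳ-unique s x sx≈s)
          (r , r∈B , _ , s≈sxr) ← s∈Nbhd sx∈B (W⇒≉ε W[sx])
          let xr≈ε : x ∙ r ≈ ε
              xr≈ε = identityʳ-unique s (x ∙ r) (trans (sym (assoc s x r)) (sym s≈sxr))
          yes x≈r ← ¬¬-excluded-middle
            where no x≉r → λ _ → ε∉2∧B (wedge-resp xr≈ε (wedge x∈B r∈B x≉r))
          return (inj₁ (trans (∙-congˡ x≈r) xr≈ε))

        order≤2 : ¬ ¬ (x ∙ x ≈ ε)
        order≤2 = do
          (z , z∈B , z≉ε ∷ z≉x ∷ z≉x′ ∷ []) ←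
            ¬¬-outside (ε ∷ x ∷ x′ ∷ []) B! (≤-trans (s≤s (s≤s (s≤s (s≤s z≤n)))) 5≤|B|)
          (z′ , z′∈B , z′≉z , s≈zz′) ← s∈Nbhd z∈B z≉ε
          let z′≉x : ¬ z′ ≈ x
              z′≉x z′≈x = z≉x′ (∙-cancelˡ x z x′
                (trans (sym (trans s≈zz′ (trans (∙-congˡ z′≈x) (comm z x)))) s≈xx′))
              z′≉x′ : ¬ z′ ≈ x′
              z′≉x′ z′≈x′ = z≉x (∙-cancelʳ x′ z x
                (trans (sym (trans s≈zz′ (∙-congˡ z′≈x′))) s≈xx′))
          inj₂ xz≈z′ ← shift-or-involution z∈B z′∈B z≉x z≉x′ s≈zz′
            where inj₁ xx≈ε → return xx≈ε
          inj₂ xz′≈z ← shift-or-involution z′∈B z∈B z′≉x z′≉x′ (trans s≈zz′ (comm z z′))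
            where inj₁ xx≈ε → return xx≈ε
          return (identityˡ-unique (x ∙ x) (z ∙ z′) (begin
            (x ∙ x) ∙ (z ∙ z′) ≈⟨ interchange x x z z′ ⟩
            (x ∙ z) ∙ (x ∙ z′) ≈⟨ ∙-cong xz≈z′ xz′≈z ⟩
            z′ ∙ z             ≈⟨ comm z′ z ⟩
            z ∙ z′             ∎))

      B-order≤2 : x ∈ B → ¬ ¬ (x ∙ x ≈ ε)
      B-order≤2 {x} x∈B = do
        no x≉ε ← ¬¬-excluded-middle
          where yes x≈ε → return (trans (∙-cong x≈ε x≈ε) (identityˡ ε))
        (x′ , x′∈B , x′≉x , s≈xx′) ← s∈Nbhd x∈B x≉ε
        OrderTwo.order≤2 x∈B x≉ε x′∈B x′≉x s≈xx′

      s-order≤2 : ¬ ¬ (s ∙ s ≈ ε)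
      s-order≤2 = do
        let (a , b , a∈B , b∈B , _ , s≈ab) = W[s]
        aa≈ε ← B-order≤2 a∈B
        bb≈ε ← B-order≤2 b∈B
        return (begin
          s ∙ s             ≈⟨ ∙-cong s≈ab s≈ab ⟩
          (a ∙ b) ∙ (a ∙ b) ≈⟨ interchange a b a b ⟩
          (a ∙ a) ∙ (b ∙ b) ≈⟨ ∙-cong aa≈ε bb≈ε ⟩
          ε ∙ ε             ≈⟨ identityˡ ε ⟩
          ε                 ∎)

      H-order≤2 : x ∈ H → ¬ ¬ (x ∙ x ≈ ε)
      H-order≤2 (here x≈s)  = s-order≤2 >>= λ ss≈ε → return (trans (∙-cong x≈s x≈s) ss≈ε)
      H-order≤2 (there x∈B) = B-order≤2 x∈B

      -- s + y ∈ H for y ∈ B: for y ≠ 0 write s = y + w, so s + y = w + 2y = w.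
      s+B⊆H : y ∈ B → ¬ ¬ (s ∙ y ∈ H)
      s+B⊆H {y} y∈B = do
        no y≉ε ← ¬¬-excluded-middle
          where yes y≈ε → return (here (trans (∙-congˡ y≈ε) (identityʳ s)))
        (w , w∈B , _ , s≈yw) ← s∈Nbhd y∈B y≉ε
        yy≈ε ← B-order≤2 y∈B
        return (there (∈-resp-≈ setoid (sym (begin
          s ∙ y       ≈⟨ ∙-congʳ s≈yw ⟩
          (y ∙ w) ∙ y ≈⟨ xy∙z≈y∙xz y w y ⟩
          w ∙ (y ∙ y) ≈⟨ ∙-congˡ yy≈ε ⟩
          w ∙ ε       ≈⟨ identityʳ w ⟩
          w           ∎)) w∈B))

      -- H is closed: 2x = 0 ∈ H, s + B ⊆ H, and x + y ∈ 2∧B ⊆ H for distinct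
      -- x, y ∈ B.
      H-closed : x ∈ H → y ∈ H → ¬ ¬ (x ∙ y ∈ H)
      H-closed {x} {y} x∈H y∈H = do
        no x≉y ← ¬¬-excluded-middle
          where yes x≈y → H-order≤2 x∈H >>= λ xx≈ε →
                  return (there (∈-resp-≈ setoid (sym (trans (∙-congˡ (sym x≈y)) xx≈ε)) ε∈B))
        distinct x∈H y∈H x≉y
        where
        distinct : x ∈ H → y ∈ H → ¬ x ≈ y → ¬ ¬ (x ∙ y ∈ H)
        distinct (here x≈s)  (here y≈s)  x≉y = λ _ → x≉y (trans x≈s (sym y≈s))
        distinct (here x≈s)  (there y∈B) _   =
          s+B⊆H y∈B >>= λ sy∈H → return (∈-resp-≈ setoid (∙-congʳ (sym x≈s)) sy∈H)
        distinct (there x∈B) (here y≈s)  _   =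
          s+B⊆H x∈B >>= λ sx∈H →
          return (∈-resp-≈ setoid (trans (comm s x) (∙-congˡ (sym y≈s))) sx∈H)
        distinct (there x∈B) (there y∈B) x≉y = 2∧B⊆H (wedge x∈B y∈B x≉y) >>= λ where
          (inj₁ xy∈B) → return (there xy∈B)
          (inj₂ xy≈s) → return (here xy≈s)

      -- Since H is finite, the pointwise (double-negated) facts above combine
      -- into a single one; inverses exist because x⁻¹ = x.
      H-elementary : ¬ ¬ IsElementary2Subgroup G H
      H-elementary = do
        closure ← ¬¬-∀∈ (λ x≈x′ P {y} y∈H → ∈-resp-≈ setoid (∙-congʳ x≈x′) (P y∈H)) H
                    (λ x∈H → ¬¬-∀∈ (λ y≈y′ → ∈-resp-≈ setoid (∙-congˡ y≈y′)) H (H-closed x∈H))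
        orders ← ¬¬-∀∈ (λ x≈x′ xx≈ε → trans (∙-cong (sym x≈x′) (sym x≈x′)) xx≈ε) H H-order≤2
        return ( there ε∈B
               , (λ _ _ x∈H y∈H → closure x∈H y∈H)
               , (λ x x∈H → ∈-resp-≈ setoid (inverseʳ-unique x x (orders x∈H)) x∈H)
               , (λ _ x∈H _ → orders x∈H) )

      absurd : ⊥
      absurd = H-elementary (no-extension s s∉B)

    -- The second case is impossible, so the first applies.
    closed : x ∈ B → y ∈ B → ¬ ¬ (x ∙ y ∈ B)
    closed x∈B y∈B = do
      no outside ← ¬¬-excluded-middle {A = ∃ λ t → W t × t ∉ B}
        where yes (s , W[s] , s∉B) → λ _ → WedgeOutside.absurd s W[s] s∉B
      WedgeInside.closed (λ W[t] t∉B → outside (_ , W[t] , t∉B)) x∈B y∈B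

  module _ {P : Carrier → Set (c ⊔ ℓ)} {n : ℕ} (P-size : HasSize G P n) where
    private
      L = proj₁ P-size
      L! = proj₁ (proj₂ P-size)
      |L|≡n = proj₁ (proj₂ (proj₂ P-size))
      P⇔∈L = proj₂ (proj₂ (proj₂ P-size))

    HasSize⇒AtMost : AtMost P n
    HasSize⇒AtMost = ≡.subst (AtMost P) |L|≡n
      (atMost-⊆ (λ {x} Px → return (Equivalence.to (P⇔∈L x) Px)) (atMost-list L))

    -- If P ⊆ Q and Q has at most k elements, then n ≤ k (a decidable, hence
    -- stable, conclusion).
    size-≤ : ∀ {q k} {Q : Carrier → Set q} → (∀ {x} → P x → ¬ ¬ Q x) → AtMost Q k → n ≤ k
    size-≤ {k = k} P⊆Q Q≤k = decidable-stable (n ≤? k) (do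
      |L|≤k ← Q≤k L L! (λ {x} x∈L → P⊆Q (Equivalence.from (P⇔∈L x) x∈L))
      return (≡.subst (_≤ k) |L|≡n |L|≤k))

  module _ {A : List Carrier} where

    wedge⊆sumset : In2Wedge G A x → InSumset G A x
    wedge⊆sumset (a , b , a∈A , b∈A , _ , x≈ab) = a , b , a∈A , b∈A , x≈ab

    sumset⊆wedge : (∀ {a} → a ∈ A → ¬ ¬ In2Wedge G A (a ∙ a)) →
                   InSumset G A x → ¬ ¬ In2Wedge G A x
    sumset⊆wedge doubles (a , b , a∈A , b∈A , x≈ab) = do
      yes a≈b ← ¬¬-excluded-middle
        where no a≉b → return (wedge-resp (sym x≈ab) (wedge a∈A b∈A a≉b))
      W[aa] ← doubles a∈A
      return (wedge-resp (sym (trans x≈ab (∙-congˡ (sym a≈b)))) W[aa])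

    -- |A| ≤ |A + A|, as a + A ⊆ A + A.
    |A|≤|A+A| : ∀ {a n} → a ∈ A → Unique A → HasSize G (InSumset G A) n → length A ≤ n
    |A|≤|A+A| {a} {n} a∈A A! A+A-size = decidable-stable (length A ≤? n) (do
      le ← HasSize⇒AtMost A+A-size (map (a ∙_) A)
             (Unique.map⁺ setoid setoid (∙-cancelˡ a _ _) A!)
             (λ y∈a+A → let (b , b∈A , y≈ab) = ∈-map⁻ setoid setoid y∈a+A in
                        return (a , b , a∈A , b∈A , y≈ab))
      return (≡.subst (_≤ n) (length-map (a ∙_) A) le))

  -- Translating A by -b, where 2b ∉ 2∧A, gives a set B = A - b satisfying
  -- the hypotheses of the closure criterion; its closedness means
  -- A + A ⊆ b + A.
  module Translate (A : List Carrier) (A! : Unique A) (5≤|A| : 5 ≤ length A)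
    (A-not-almost : ¬ IsAlmost2Coset G A) (2∧A≤|A| : AtMost (In2Wedge G A) (length A))
    {b} (b∈A : b ∈ A) (2b∉2∧A : ¬ In2Wedge G A (b ∙ b)) where

    shift : Carrier → Carrier
    shift a = a ∙ b ⁻¹

    B : List Carrier
    B = map shift A

    shift∙b : ∀ a → shift a ∙ b ≈ a
    shift∙b a = begin
      (a ∙ b ⁻¹) ∙ b ≈⟨ assoc a (b ⁻¹) b ⟩
      a ∙ (b ⁻¹ ∙ b) ≈⟨ ∙-congˡ (inverseˡ b) ⟩
      a ∙ ε          ≈⟨ identityʳ a ⟩
      a              ∎

    b∙shift : ∀ a → b ∙ shift a ≈ a
    b∙shift a = trans (comm b (shift a)) (shift∙b a)

    shift-b∙ : ∀ a → shift (b ∙ a) ≈ a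
    shift-b∙ a = ∙-cancelʳ b (shift (b ∙ a)) a (trans (shift∙b (b ∙ a)) (comm b a))

    shift-sum : ∀ a a′ → (shift a ∙ shift a′) ∙ (b ∙ b) ≈ a ∙ a′
    shift-sum a a′ =
      trans (interchange (shift a) (shift a′) b b) (∙-cong (shift∙b a) (shift∙b a′))

    shift-injective : shift x ≈ shift y → x ≈ y
    shift-injective {x} {y} = ∙-cancelʳ (b ⁻¹) x y

    ∈B⁻ : y ∈ B → ∃ λ a → a ∈ A × y ≈ shift a
    ∈B⁻ = ∈-map⁻ setoid setoid

    ∈B⁺ : a ∈ A → shift a ∈ B
    ∈B⁺ = ∈-map⁺ setoid setoid ∙-congʳ

    wedge-shift : In2Wedge G B x → In2Wedge G A (x ∙ (b ∙ b))
    wedge-shift {x} (p , p′ , p∈B , p′∈B , p≉p′ , x≈pp′) =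
      let (a , a∈A , p≈a) = ∈B⁻ p∈B ; (a′ , a′∈A , p′≈a′) = ∈B⁻ p′∈B in
      wedge-resp (begin
          a ∙ a′                          ≈⟨ shift-sum a a′ ⟨
          (shift a ∙ shift a′) ∙ (b ∙ b)  ≈⟨ ∙-congʳ (∙-cong p≈a p′≈a′) ⟨
          (p ∙ p′) ∙ (b ∙ b)              ≈⟨ ∙-congʳ x≈pp′ ⟨
          x ∙ (b ∙ b)                     ∎)
        (wedge a∈A a′∈A (λ a≈a′ → p≉p′ (trans p≈a (trans (∙-congʳ a≈a′) (sym p′≈a′)))))

    B! : Unique B
    B! = Unique.map⁺ setoid setoid shift-injective A!

    5≤|B| : 5 ≤ length B
    5≤|B| = ≡.subst (5 ≤_) (≡.sym (length-map shift A)) 5≤|A|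

    ε∈B : ε ∈ B
    ε∈B = ∈-resp-≈ setoid (inverseʳ b) (∈B⁺ b∈A)

    ε∉2∧B : ¬ In2Wedge G B ε
    ε∉2∧B W[ε] = 2b∉2∧A (wedge-resp (identityˡ (b ∙ b)) (wedge-shift W[ε]))

    2∧B≤|B| : AtMost (In2Wedge G B) (length B)
    2∧B≤|B| = ≡.subst (AtMost (In2Wedge G B)) (≡.sym (length-map shift A))
      (atMost-image (_∙ (b ∙ b)) (λ {x} {y} → ∙-cancelʳ (b ∙ b) x y)
                    wedge-resp wedge-shift 2∧A≤|A|)

    -- If B ∪ {s} were an elementary 2-subgroup, A = b + B would be the
    -- almost 2-coset (b + (B ∪ {s})) ∖ {b + s}.
    no-extension : ∀ s → s ∉ B → ¬ IsElementary2Subgroup G (s ∷ B)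
    no-extension s s∉B H-elementary =
      A-not-almost ( s ∷ B , b , b ∙ s , H-elementary , (s , here refl , refl)
                   , λ x → mk⇔ (to x) (from x))
      where
      to : ∀ x → x ∈ A → InCoset G b (s ∷ B) x × ¬ x ≈ b ∙ s
      to x x∈A = (shift x , there (∈B⁺ x∈A) , sym (b∙shift x)) ,
                 λ x≈bs → s∉B (∈-resp-≈ setoid (trans (∙-congʳ x≈bs) (shift-b∙ s)) (∈B⁺ x∈A))
      from : ∀ x → InCoset G b (s ∷ B) x × ¬ x ≈ b ∙ s → x ∈ A
      from x ((h , here h≈s , x≈bh) , x≉bs) = contradiction (trans x≈bh (∙-congˡ h≈s)) x≉bs
      from x ((h , there h∈B , x≈bh) , _) =
        let (a , a∈A , h≈a) = ∈B⁻ h∈B in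
        ∈-resp-≈ setoid (sym (trans x≈bh (trans (∙-congˡ h≈a) (b∙shift a)))) a∈A

    open ClosureCriterion B B! 5≤|B| ε∈B ε∉2∧B 2∧B≤|B| no-extension using (closed)

    -- A + A ⊆ b + A: for a, a′ ∈ A, shift a + shift a′ = shift c with c ∈ A,
    -- so a + a′ = shift c + 2b = b + c.
    sumset⊆b+A : InSumset G A t → ¬ ¬ (t ∈ map (b ∙_) A)
    sumset⊆b+A {t} (a , a′ , a∈A , a′∈A , t≈aa′) = do
      sum∈B ← closed (∈B⁺ a∈A) (∈B⁺ a′∈A)
      let (c , c∈A , sum≈c) = ∈B⁻ sum∈B
      return (∈-resp-≈ setoid (sym (begin
        t                              ≈⟨ t≈aa′ ⟩
        a ∙ a′                         ≈⟨ shift-sum a a′ ⟨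
        (shift a ∙ shift a′) ∙ (b ∙ b) ≈⟨ ∙-congʳ sum≈c ⟩
        shift c ∙ (b ∙ b)              ≈⟨ x∙yz≈y∙xz (shift c) b b ⟩
        b ∙ (shift c ∙ b)              ≈⟨ ∙-congˡ (shift∙b c) ⟩
        b ∙ c                          ∎)) (∈-map⁺ setoid setoid ∙-congˡ c∈A))

  -- Either 2a ∈ 2∧A for every a ∈ A, and then
  -- A + A = 2∧A; or 2b ∉ 2∧A for some b ∈ A, and then A + A ⊆ b + A.
  small-wedge⇒small-sumset : ∀ {A} → Unique A → 5 ≤ length A → ¬ IsAlmost2Coset G A →
    AtMost (In2Wedge G A) (length A) → AtMost (InSumset G A) (length A)
  small-wedge⇒small-sumset {A} A! 5≤|A| A-not-almost 2∧A≤|A| xs xs! xs⊆A+A = do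
    no no-odd-double ← ¬¬-excluded-middle {A = ∃ λ b → b ∈ A × ¬ In2Wedge G A (b ∙ b)}
      where yes (b , b∈A , 2b∉2∧A) →
              atMost-⊆ (Translate.sumset⊆b+A A A! 5≤|A| A-not-almost 2∧A≤|A| b∈A 2b∉2∧A)
                (≡.subst (AtMost _) (length-map (b ∙_) A) (atMost-list (map (b ∙_) A)))
                xs xs! xs⊆A+A
    atMost-⊆ (sumset⊆wedge (λ a∈A 2a∉2∧A → no-odd-double (_ , a∈A , 2a∉2∧A))) 2∧A≤|A|
      xs xs! xs⊆A+A

open GroupLemmas

lemma7 : ∀ {c ℓ} (G : AbelianGroup c ℓ) (A : List (AbelianGroup.Carrier G)) →
    Distinct G A → 5 ≤ length A → ¬ IsAlmost2Coset G A →
    ∀ (m n : ℕ) → HasSize G (In2Wedge G A) m → HasSize G (InSumset G A) n →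
    (m ≤ length A) ⇔ (n ≡ length A)
lemma7 G A A! 5≤|A| A-not-almost m n 2∧A-size A+A-size = mk⇔ sumset-small wedge-small
  where
  open FiniteSets (AbelianGroup.setoid G) using (atMost-weaken; nonempty)

  sumset-small : m ≤ length A → n ≡ length A
  sumset-small m≤|A| = ≤-antisym
    (size-≤ G A+A-size return
      (small-wedge⇒small-sumset G A! 5≤|A| A-not-almost
        (atMost-weaken (HasSize⇒AtMost G 2∧A-size) m≤|A|)))
    (|A|≤|A+A| G (proj₂ (nonempty (≤-trans (s≤s z≤n) 5≤|A|))) A! A+A-size)

  -- 2∧A ⊆ A + A, so |2∧A| ≤ |A + A| = |A|.
  wedge-small : n ≡ length A → m ≤ length A
  wedge-small n≡|A| = ≡.subst (m ≤_) n≡|A|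
    (size-≤ G 2∧A-size (λ W[x] → return (wedge⊆sumset G W[x])) (HasSize⇒AtMost G A+A-size))
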